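{- Let $\mathcal{D}=\langle Q,\mu_0,L,\delta\rangle$ be an MDP, let $w=a_1a_2\cdots a_n\in L^*$, and let $\mu_1,\ldots,\mu_n$ be subdistributions over $Q$ (with $\mu_0$ the initial distribution). Then there is a strategy $\alpha$ of $\mathcal{D}$ with $\mu_i=\mathit{subDis}_{\mathcal{D},\alpha}(a_1\cdots a_i)$ for all $i\in\{0,1,\ldots,n\}$ if and only if there are local strategies $\alpha_0,\ldots,\alpha_{n-1}$ with $\mu_{i+1}=\mathsf{Succ}(\mu_i,\alpha_i,a_{i+1})$ for all $i\in\{0,\ldots,n-1\}$.
   Context: MDP $\langle Q,\mu_0,L,\delta\rangle$: finite states $Q$, initial distribution $\mu_0$, finite labels $L$, each state $q$ has a finite nonempty set $\mathsf{moves}(q)$ of moves, each a probability distribution over $L\times Q$. A strategy maps each finite path $\rho=q_0a_1q_1\cdots a_kq_k$ to a distribution over $\mathsf{moves}(q_k)$; $\Pr_{\mathcal{D},\alpha}(q_0)=\mu_0(q_0)$, $\Pr_{\mathcal{D},\alpha}(\rho aq)=\Pr_{\mathcal{D},\alpha}(\rho)\sum_{\mathsf{m}}\alpha(\rho)(\mathsf{m})\mathsf{m}(a,q)$. $\mathit{subDis}_{\mathcal{D},\alpha}(w)(q)$ is the sum of $\Pr_{\mathcal{D},\alpha}(\rho)$ over paths with trace $w$ and last state $q$. Subdistributions on $Q$ are row vectors. A local strategy $\alpha$ assigns to each $q$ a distribution on $\mathsf{moves}(q)$; $\Delta_\alpha(a)[q,q']=\sum_{\mathsf{m}}\alpha(q)(\mathsf{m})\mathsf{m}(a,q')$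 and $\mathsf{Succ}(\mu,\alpha,a)=\mu\Delta_\alpha(a)$.
   Formalization: All probabilities are rational: the initial distribution μ₀, the moves, the strategies, the local strategies and the subdistributions μ₁,…,μₙ take values in ℚ. -}

module Defs where

open import Data.Nat using (ℕ; zero; suc)
open import Data.Fin using (Fin; zero; suc; _≟_)
open import Data.List using (List; []; _∷_; map; filter; reverse; foldr; concatMap; allFin)
open import Data.Vec using (Vec; []; _∷_)
open import Data.Rational using (ℚ; 0ℚ; 1ℚ; _+_; _*_; _≤_)
open import Data.Product using (_×_)
open import Function using (_∘_)
open import Relation.Binary.PropositionalEquality using (_≡_)

∑ : (n : ℕ) → (Fin n → ℚ) → ℚ
∑ zero    f = 0ℚ
∑ (suc n) f = f zero + ∑ n (f ∘ suc)

IsDist : (n : ℕ) → (Fin n → ℚ) → Set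
IsDist n f = (∀ i → 0ℚ ≤ f i) × (∑ n f ≡ 1ℚ)

IsSubDist : (n : ℕ) → (Fin n → ℚ) → Set
IsSubDist n f = (∀ i → 0ℚ ≤ f i) × (∑ n f ≤ 1ℚ)

-- MDP with states Q = Fin k and labels L = Fin l.
-- State q has the nonempty finite set of moves Fin (suc (nmoves q));
-- move m at q is the distribution (a , q') ↦ δ q m a q' over L × Q.
record MDP (k l : ℕ) : Set where
  field
    μ₀       : Fin k → ℚ
    μ₀-dist  : IsDist k μ₀
    nmoves   : Fin k → ℕ
    δ        : (q : Fin k) → Fin (suc (nmoves q)) → Fin l → Fin k → ℚ
    δ-nonneg : ∀ q m a q' → 0ℚ ≤ δ q m a q'
    δ-sum    : ∀ q m → ∑ l (λ a → ∑ k (λ q' → δ q m a q')) ≡ 1ℚ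

module _ {k l : ℕ} (M : MDP k l) where
  open MDP M

  Moves : Fin k → Set
  Moves q = Fin (suc (nmoves q))

  data Path : Set where
    start : Fin k → Path
    step  : Path → Fin l → Fin k → Path

  last : Path → Fin k
  last (start q)    = q
  last (step _ _ q) = q

  record Strategy : Set where
    field
      choose      : (ρ : Path) → Moves (last ρ) → ℚ
      choose-dist : ∀ ρ → IsDist (suc (nmoves (last ρ))) (choose ρ)
  open Strategy

  Pr : Strategy → Path → ℚ
  Pr α (start q)    = μ₀ q
  Pr α (step ρ a q) =
    Pr α ρ * ∑ (suc (nmoves (last ρ))) (λ m → choose α ρ m * δ (last ρ) m a q)

  -- All paths whose trace is the REVERSE of the given word (each exactly once).
  pathsRev : List (Fin l) → List Path
  pathsRev []       = map start (allFin k)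
  pathsRev (a ∷ ws) = concatMap (λ ρ → map (step ρ a) (allFin k)) (pathsRev ws)

  pathsWith : List (Fin l) → List Path
  pathsWith w = pathsRev (reverse w)

  sumℚ : List ℚ → ℚ
  sumℚ = foldr _+_ 0ℚ

  subDis : Strategy → List (Fin l) → Fin k → ℚ
  subDis α w q =
    sumℚ (map (Pr α) (filter {P = λ ρ → last ρ ≡ q} (λ ρ → last ρ ≟ q) (pathsWith w)))

  record LocalStrategy : Set where
    field
      loc      : (q : Fin k) → Moves q → ℚ
      loc-dist : ∀ q → IsDist (suc (nmoves q)) (loc q)
  open LocalStrategy

  Δ : LocalStrategy → Fin l → Fin k → Fin k → ℚ
  Δ β a q q' = ∑ (suc (nmoves q)) (λ m → loc β q m * δ q m a q')

  Succ : (Fin k → ℚ) → LocalStrategy → Fin l → Fin k → ℚ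
  Succ μ β a q' = ∑ k (λ q → μ q * Δ β a q q')

prefix : {A : Set} {n : ℕ} → Vec A n → Fin (suc n) → List A
prefix _        zero    = []
prefix (a ∷ as) (suc i) = a ∷ prefix as i

{-# OPTIONS --safe #-}
module Submission where

-- Let flow α u q m be the probability, under α, of reading u, ending in q and then choosing
-- move m. Summing over m gives subDis α u q, and one δ-step turns the flow into subDis α (u a).
-- Hence subDis α (u a) = Succ (subDis α u, β, a) whenever flow α u q m = subDis α u q · β(q)(m).
-- A strategy yields such a β after every prefix by normalising its flow; conversely, the strategy
-- that plays the i-th local strategy on paths of length i has exactly this flow.

open import Defs
open import Algebra.Bundles using (CommutativeRing)
open import Data.Bool using (if_then_else_)
open import Data.Fin using (Fin; zero; suc; _≟_; inject₁; toℕ)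
open import Data.Fin.Induction using (<-weakInduction)
open import Data.Fin.Properties using (toℕ-inject₁)
open import Data.List
  using (List; []; _∷_; _++_; _∷ʳ_; map; foldr; filter; concatMap; tabulate; allFin; reverse; length)
open import Data.List.Properties using (reverse-++; length-reverse)
open import Data.Nat using (ℕ; zero; suc)
open import Data.Product using (Σ; _×_; _,_; proj₁; proj₂)
open import Data.Rational using (ℚ; 0ℚ; 1ℚ; _+_; _*_; _≤_; 1/_; NonZero; Positive; ≢-nonZero; nonNegative)
  renaming (_≟_ to _≟ℚ_)
open import Data.Rational.Properties
  using ( +-identityˡ; +-identityʳ; +-assoc; *-identityˡ; *-identityʳ; *-zeroˡ; *-zeroʳ; *-comm
        ; *-assoc; *-distribʳ-+; *-inverseˡ; *-inverseʳ; ≤-refl; ≤-antisym; +-mono-≤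
        ; nonNegative⁻¹; nonNeg*nonNeg⇒nonNeg; nonNeg∧nonZero⇒pos; *-cancelˡ-≤-pos
        ; +-*-commutativeRing )
open import Data.Vec using (Vec; []; _∷_; lookup)
import Data.Vec as Vec
open import Data.Vec.Properties using (lookup∘tabulate)
open import Function using (_∘_; id)
open import Function.Bundles using (_⇔_; mk⇔)
open import Relation.Nullary using (does; yes; no)
open import Relation.Binary.PropositionalEquality
open ≡-Reasoning

open import Algebra.Properties.Semiring.Sum (CommutativeRing.semiring +-*-commutativeRing)
  using (sum; sum-replicate-zero; ∑-distrib-+; *-distribˡ-sum)

∑≡sum : (n : ℕ) (f : Fin n → ℚ) → ∑ n f ≡ sum f
∑≡sum zero    f = refl
∑≡sum (suc n) f = cong (f zero +_) (∑≡sum n (f ∘ suc))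

∑-cong : (n : ℕ) {f g : Fin n → ℚ} → (∀ i → f i ≡ g i) → ∑ n f ≡ ∑ n g
∑-cong zero    f≗g = refl
∑-cong (suc n) f≗g = cong₂ _+_ (f≗g zero) (∑-cong n (f≗g ∘ suc))

∑-zero : (n : ℕ) → ∑ n (λ _ → 0ℚ) ≡ 0ℚ
∑-zero n = trans (∑≡sum n _) (sum-replicate-zero n)

∑-+ : (n : ℕ) (f g : Fin n → ℚ) → ∑ n (λ i → f i + g i) ≡ ∑ n f + ∑ n g
∑-+ n f g = begin
  ∑ n (λ i → f i + g i)  ≡⟨ ∑≡sum n _ ⟩
  sum (λ i → f i + g i)  ≡⟨ ∑-distrib-+ f g ⟩
  sum f + sum g          ≡⟨ sym (cong₂ _+_ (∑≡sum n f) (∑≡sum n g)) ⟩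
  ∑ n f + ∑ n g          ∎

∑-*ˡ : (n : ℕ) (c : ℚ) (f : Fin n → ℚ) → c * ∑ n f ≡ ∑ n (λ i → c * f i)
∑-*ˡ n c f = begin
  c * ∑ n f              ≡⟨ cong (c *_) (∑≡sum n f) ⟩
  c * sum f              ≡⟨ *-distribˡ-sum c f ⟩
  sum (λ i → c * f i)    ≡⟨ sym (∑≡sum n _) ⟩
  ∑ n (λ i → c * f i)    ∎

∑-nonNeg : (n : ℕ) {f : Fin n → ℚ} → (∀ i → 0ℚ ≤ f i) → 0ℚ ≤ ∑ n f
∑-nonNeg zero    f≥0 = ≤-refl
∑-nonNeg (suc n) f≥0 = +-mono-≤ (f≥0 zero) (∑-nonNeg n (f≥0 ∘ suc))

term≤∑ : (n : ℕ) {f : Fin n → ℚ} → (∀ i → 0ℚ ≤ f i) → ∀ i → f i ≤ ∑ n f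
term≤∑ (suc n) {f} f≥0 zero =
  subst (_≤ ∑ (suc n) f) (+-identityʳ (f zero)) (+-mono-≤ (≤-refl {f zero}) (∑-nonNeg n (f≥0 ∘ suc)))
term≤∑ (suc n) {f} f≥0 (suc i) =
  subst (_≤ ∑ (suc n) f) (+-identityˡ (f (suc i))) (+-mono-≤ (f≥0 zero) (term≤∑ n (f≥0 ∘ suc) i))

∑≡0⇒≡0 : (n : ℕ) {f : Fin n → ℚ} → (∀ i → 0ℚ ≤ f i) → ∑ n f ≡ 0ℚ → ∀ i → f i ≡ 0ℚ
∑≡0⇒≡0 n {f} f≥0 ∑f≡0 i = ≤-antisym (subst (f i ≤_) ∑f≡0 (term≤∑ n f≥0 i)) (f≥0 i)

𝟙 : {n : ℕ} → Fin n → Fin n → ℚ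
𝟙 i j = if does (i ≟ j) then 1ℚ else 0ℚ

𝟙-sym : {n : ℕ} (i j : Fin n) → 𝟙 i j ≡ 𝟙 j i
𝟙-sym zero    zero    = refl
𝟙-sym zero    (suc j) = refl
𝟙-sym (suc i) zero    = refl
𝟙-sym (suc i) (suc j) = 𝟙-sym i j

∑-𝟙ˡ : (n : ℕ) (i : Fin n) (f : Fin n → ℚ) → ∑ n (λ j → 𝟙 j i * f j) ≡ f i
∑-𝟙ˡ (suc n) zero f = begin
  1ℚ * f zero + ∑ n (λ j → 0ℚ * f (suc j))
    ≡⟨ cong₂ _+_ (*-identityˡ (f zero)) (trans (∑-cong n (λ j → *-zeroˡ (f (suc j)))) (∑-zero n)) ⟩
  f zero + 0ℚ
    ≡⟨ +-identityʳ (f zero) ⟩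
  f zero ∎
∑-𝟙ˡ (suc n) (suc i) f = begin
  0ℚ * f zero + ∑ n (λ j → 𝟙 j i * f (suc j))  ≡⟨ cong₂ _+_ (*-zeroˡ (f zero)) (∑-𝟙ˡ n i (f ∘ suc)) ⟩
  0ℚ + f (suc i)                              ≡⟨ +-identityˡ (f (suc i)) ⟩
  f (suc i)                                   ∎

∑-𝟙ʳ : (n : ℕ) (i : Fin n) (f : Fin n → ℚ) → ∑ n (λ j → 𝟙 i j * f j) ≡ f i
∑-𝟙ʳ n i f = trans (∑-cong n (λ j → cong (_* f j) (𝟙-sym i j))) (∑-𝟙ˡ n i f)

*-nonNeg : {p q : ℚ} → 0ℚ ≤ p → 0ℚ ≤ q → 0ℚ ≤ p * q
*-nonNeg {p} {q} 0≤p 0≤q =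
  nonNegative⁻¹ (p * q) {{nonNeg*nonNeg⇒nonNeg p {{nonNegative 0≤p}} q {{nonNegative 0≤q}}}}

dirac₀ : {n : ℕ} → Fin (suc n) → ℚ
dirac₀ zero    = 1ℚ
dirac₀ (suc _) = 0ℚ

dirac₀-isDist : (n : ℕ) → IsDist (suc n) dirac₀
dirac₀-isDist n = dirac₀-nonNeg , trans (cong (1ℚ +_) (∑-zero n)) (+-identityʳ 1ℚ)
  where
  dirac₀-nonNeg : (i : Fin (suc n)) → 0ℚ ≤ dirac₀ i
  dirac₀-nonNeg zero    = nonNegative⁻¹ 1ℚ
  dirac₀-nonNeg (suc _) = ≤-refl

-- When all the mass is 0, any distribution will do.
normalise : {n : ℕ} (f : Fin (suc n) → ℚ) → (∀ i → 0ℚ ≤ f i) →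
            Σ (Fin (suc n) → ℚ) λ p → IsDist (suc n) p × (∀ i → f i ≡ ∑ (suc n) f * p i)
normalise {n} f f≥0 with ∑ (suc n) f ≟ℚ 0ℚ
... | yes ∑f≡0 = dirac₀ , dirac₀-isDist n , λ i → begin
  f i                   ≡⟨ ∑≡0⇒≡0 (suc n) f≥0 ∑f≡0 i ⟩
  0ℚ                    ≡⟨ sym (*-zeroˡ (dirac₀ i)) ⟩
  0ℚ * dirac₀ i         ≡⟨ cong (_* dirac₀ i) (sym ∑f≡0) ⟩
  ∑ (suc n) f * dirac₀ i ∎
... | no ∑f≢0 = p , (p≥0 , ∑p≡1) , f≡∑f*p
  where
  s : ℚ
  s = ∑ (suc n) f
  instance
    s≢0 : NonZero s
    s≢0 = ≢-nonZero ∑f≢0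
  p : Fin (suc n) → ℚ
  p i = 1/ s * f i
  f≡∑f*p : ∀ i → f i ≡ s * p i
  f≡∑f*p i = begin
    f i              ≡⟨ sym (*-identityˡ (f i)) ⟩
    1ℚ * f i         ≡⟨ cong (_* f i) (sym (*-inverseʳ s)) ⟩
    s * 1/ s * f i   ≡⟨ *-assoc s (1/ s) (f i) ⟩
    s * p i          ∎
  p≥0 : ∀ i → 0ℚ ≤ p i
  p≥0 i = *-cancelˡ-≤-pos s {{s>0}} (subst₂ _≤_ (sym (*-zeroʳ s)) (f≡∑f*p i) (f≥0 i))
    where
    s>0 : Positive s
    s>0 = nonNeg∧nonZero⇒pos s {{nonNegative (∑-nonNeg (suc n) f≥0)}}
  ∑p≡1 : ∑ (suc n) p ≡ 1ℚ
  ∑p≡1 = trans (sym (∑-*ˡ (suc n) (1/ s) f)) (*-inverseˡ s)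

module _ {A : Set} where

  sumOver : List A → (A → ℚ) → ℚ
  sumOver xs f = foldr _+_ 0ℚ (map f xs)

  sumOver-cong : (xs : List A) {f g : A → ℚ} → (∀ x → f x ≡ g x) → sumOver xs f ≡ sumOver xs g
  sumOver-cong []       f≗g = refl
  sumOver-cong (x ∷ xs) f≗g = cong₂ _+_ (f≗g x) (sumOver-cong xs f≗g)

  sumOver-++ : (xs ys : List A) (f : A → ℚ) → sumOver (xs ++ ys) f ≡ sumOver xs f + sumOver ys f
  sumOver-++ []       ys f = sym (+-identityˡ (sumOver ys f))
  sumOver-++ (x ∷ xs) ys f =
    trans (cong (f x +_) (sumOver-++ xs ys f)) (sym (+-assoc (f x) (sumOver xs f) (sumOver ys f)))

  sumOver-*ʳ : (xs : List A) (c : ℚ) (f : A → ℚ) → sumOver xs f * c ≡ sumOver xs (λ x → f x * c)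
  sumOver-*ʳ []       c f = *-zeroˡ c
  sumOver-*ʳ (x ∷ xs) c f = trans (*-distribʳ-+ c (f x) (sumOver xs f)) (cong (f x * c +_) (sumOver-*ʳ xs c f))

  sumOver-nonNeg : (xs : List A) {f : A → ℚ} → (∀ x → 0ℚ ≤ f x) → 0ℚ ≤ sumOver xs f
  sumOver-nonNeg []       f≥0 = ≤-refl
  sumOver-nonNeg (x ∷ xs) f≥0 = +-mono-≤ (f≥0 x) (sumOver-nonNeg xs f≥0)

  ∑-sumOver-comm : (n : ℕ) (xs : List A) (f : A → Fin n → ℚ) →
                   ∑ n (λ i → sumOver xs (λ x → f x i)) ≡ sumOver xs (λ x → ∑ n (f x))
  ∑-sumOver-comm n []       f = ∑-zero n
  ∑-sumOver-comm n (x ∷ xs) f =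
    trans (∑-+ n (f x) (λ i → sumOver xs (λ y → f y i))) (cong (∑ n (f x) +_) (∑-sumOver-comm n xs f))

  sumOver-filter : {n : ℕ} (key : A → Fin n) (i : Fin n) (xs : List A) (f : A → ℚ) →
                   sumOver (filter (λ x → key x ≟ i) xs) f ≡ sumOver xs (λ x → 𝟙 (key x) i * f x)
  sumOver-filter key i []       f = refl
  sumOver-filter key i (x ∷ xs) f with key x ≟ i
  ... | yes _ = cong₂ _+_ (sym (*-identityˡ (f x))) (sumOver-filter key i xs f)
  ... | no  _ = trans (sym (+-identityˡ _)) (cong₂ _+_ (sym (*-zeroˡ (f x))) (sumOver-filter key i xs f))

  sumOver-tabulate : {n : ℕ} (g : Fin n → A) (f : A → ℚ) → sumOver (tabulate g) f ≡ ∑ n (f ∘ g)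
  sumOver-tabulate {zero}  g f = refl
  sumOver-tabulate {suc n} g f = cong (f (g zero) +_) (sumOver-tabulate (g ∘ suc) f)

module _ {A B : Set} where

  sumOver-map : (g : A → B) (xs : List A) (f : B → ℚ) → sumOver (map g xs) f ≡ sumOver xs (f ∘ g)
  sumOver-map g []       f = refl
  sumOver-map g (x ∷ xs) f = cong (f (g x) +_) (sumOver-map g xs f)

  sumOver-concatMap : (g : A → List B) (xs : List A) (f : B → ℚ) →
                      sumOver (concatMap g xs) f ≡ sumOver xs (λ x → sumOver (g x) f)
  sumOver-concatMap g []       f = refl
  sumOver-concatMap g (x ∷ xs) f =
    trans (sumOver-++ (g x) (concatMap g xs) f) (cong (sumOver (g x) f +_) (sumOver-concatMap g xs f))

sumOver-map-allFin : {B : Set} {n : ℕ} (g : Fin n → B) (f : B → ℚ) →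
                     sumOver (map g (allFin n)) f ≡ ∑ n (f ∘ g)
sumOver-map-allFin {n = n} g f = trans (sumOver-map g (allFin n) f) (sumOver-tabulate id (f ∘ g))

prefix-suc : {A : Set} {n : ℕ} (w : Vec A n) (i : Fin n) →
             prefix w (suc i) ≡ prefix w (inject₁ i) ∷ʳ lookup w i
prefix-suc (a ∷ as) zero    = refl
prefix-suc (a ∷ as) (suc i) = cong (a ∷_) (prefix-suc as i)

length-prefix : {A : Set} {n : ℕ} (w : Vec A n) (j : Fin (suc n)) → length (prefix w j) ≡ toℕ j
length-prefix w        zero    = refl
length-prefix (a ∷ as) (suc j) = cong suc (length-prefix as j)

module _ {k l : ℕ} (M : MDP k l) where
  open MDP M
  open Strategy
  open LocalStrategy

  pathLength : Path M → ℕ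
  pathLength (start _)    = zero
  pathLength (step ρ _ _) = suc (pathLength ρ)

  sumOver-pathsRev-[] : (f : Path M → ℚ) → sumOver (pathsRev M []) f ≡ ∑ k (f ∘ start)
  sumOver-pathsRev-[] = sumOver-map-allFin start

  sumOver-pathsRev-∷ : (a : Fin l) (ws : List (Fin l)) (f : Path M → ℚ) →
    sumOver (pathsRev M (a ∷ ws)) f ≡ sumOver (pathsRev M ws) (λ ρ → ∑ k (λ q → f (step ρ a q)))
  sumOver-pathsRev-∷ a ws f =
    trans (sumOver-concatMap _ (pathsRev M ws) f)
          (sumOver-cong (pathsRev M ws) (λ ρ → sumOver-map-allFin (step ρ a) f))

  sumOver-pathsRev-cong : (ws : List (Fin l)) {f g : Path M → ℚ} →
    (∀ ρ → pathLength ρ ≡ length ws → f ρ ≡ g ρ) → sumOver (pathsRev M ws) f ≡ sumOver (pathsRev M ws) g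
  sumOver-pathsRev-cong [] {f} {g} f≗g = begin
    sumOver (pathsRev M []) f  ≡⟨ sumOver-pathsRev-[] f ⟩
    ∑ k (f ∘ start)            ≡⟨ ∑-cong k (λ q → f≗g (start q) refl) ⟩
    ∑ k (g ∘ start)            ≡⟨ sym (sumOver-pathsRev-[] g) ⟩
    sumOver (pathsRev M []) g  ∎
  sumOver-pathsRev-cong (a ∷ ws) {f} {g} f≗g = begin
    sumOver (pathsRev M (a ∷ ws)) f
      ≡⟨ sumOver-pathsRev-∷ a ws f ⟩
    sumOver (pathsRev M ws) (λ ρ → ∑ k (λ q → f (step ρ a q)))
      ≡⟨ sumOver-pathsRev-cong ws (λ ρ len≡ → ∑-cong k (λ q → f≗g (step ρ a q) (cong suc len≡))) ⟩
    sumOver (pathsRev M ws) (λ ρ → ∑ k (λ q → g (step ρ a q)))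
      ≡⟨ sym (sumOver-pathsRev-∷ a ws g) ⟩
    sumOver (pathsRev M (a ∷ ws)) g ∎

  subDis-sumOver : (α : Strategy M) (u : List (Fin l)) (q : Fin k) →
    subDis M α u q ≡ sumOver (pathsWith M u) (λ ρ → 𝟙 (last M ρ) q * Pr M α ρ)
  subDis-sumOver α u q = sumOver-filter (last M) q (pathsWith M u) (Pr M α)

  subDis-[] : (α : Strategy M) (q : Fin k) → subDis M α [] q ≡ μ₀ q
  subDis-[] α q = trans (subDis-sumOver α [] q) (trans (sumOver-pathsRev-[] _) (∑-𝟙ˡ k q μ₀))

  subDis-∷ʳ : (α : Strategy M) (u : List (Fin l)) (a : Fin l) (q' : Fin k) →
    subDis M α (u ∷ʳ a) q' ≡ sumOver (pathsWith M u) (λ ρ → Pr M α (step ρ a q'))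
  subDis-∷ʳ α u a q' = begin
    subDis M α (u ∷ʳ a) q'
      ≡⟨ subDis-sumOver α (u ∷ʳ a) q' ⟩
    sumOver (pathsRev M (reverse (u ∷ʳ a))) (λ ρ → 𝟙 (last M ρ) q' * Pr M α ρ)
      ≡⟨ cong (λ ws → sumOver (pathsRev M ws) (λ ρ → 𝟙 (last M ρ) q' * Pr M α ρ)) (reverse-++ u (a ∷ [])) ⟩
    sumOver (pathsRev M (a ∷ reverse u)) (λ ρ → 𝟙 (last M ρ) q' * Pr M α ρ)
      ≡⟨ sumOver-pathsRev-∷ a (reverse u) _ ⟩
    sumOver (pathsWith M u) (λ ρ → ∑ k (λ q → 𝟙 q q' * Pr M α (step ρ a q)))
      ≡⟨ sumOver-cong (pathsWith M u) (λ ρ → ∑-𝟙ˡ k q' (λ q → Pr M α (step ρ a q))) ⟩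
    sumOver (pathsWith M u) (λ ρ → Pr M α (step ρ a q')) ∎

  Pr-nonNeg : (α : Strategy M) (ρ : Path M) → 0ℚ ≤ Pr M α ρ
  Pr-nonNeg α (start q)    = proj₁ μ₀-dist q
  Pr-nonNeg α (step ρ a q) =
    *-nonNeg (Pr-nonNeg α ρ)
             (∑-nonNeg _ (λ m → *-nonNeg (proj₁ (choose-dist α ρ) m) (δ-nonneg (last M ρ) m a q)))

  -- choose α ρ lives on the moves of last ρ; this re-indexes it by an arbitrary state,
  -- so that it can be summed over states.
  chooseAt : Strategy M → Path M → (q : Fin k) → Moves M q → ℚ
  chooseAt α ρ q with last M ρ ≟ q
  ... | yes refl = choose α ρ
  ... | no  _    = λ _ → 0ℚ

  chooseAt-nonNeg : (α : Strategy M) (ρ : Path M) (q : Fin k) (m : Moves M q) → 0ℚ ≤ chooseAt α ρ q m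
  chooseAt-nonNeg α ρ q m with last M ρ ≟ q
  ... | yes refl = proj₁ (choose-dist α ρ) m
  ... | no  _    = ≤-refl

  chooseAt-𝟙 : (α : Strategy M) (ρ : Path M) (g : (q : Fin k) → (Moves M q → ℚ) → ℚ) →
    (∀ q → g q (λ _ → 0ℚ) ≡ 0ℚ) →
    ∀ q → g q (chooseAt α ρ q) ≡ 𝟙 (last M ρ) q * g (last M ρ) (choose α ρ)
  chooseAt-𝟙 α ρ g g0≡0 q with last M ρ ≟ q
  ... | yes refl = sym (*-identityˡ _)
  ... | no  _    = trans (g0≡0 q) (sym (*-zeroˡ (g (last M ρ) (choose α ρ))))

  ∑-chooseAt : (α : Strategy M) (ρ : Path M) (q : Fin k) → ∑ (suc (nmoves q)) (chooseAt α ρ q) ≡ 𝟙 (last M ρ) q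
  ∑-chooseAt α ρ q = begin
    ∑ (suc (nmoves q)) (chooseAt α ρ q)
      ≡⟨ chooseAt-𝟙 α ρ (λ q c → ∑ (suc (nmoves q)) c) (λ q → ∑-zero (suc (nmoves q))) q ⟩
    𝟙 (last M ρ) q * ∑ (suc (nmoves (last M ρ))) (choose α ρ)
      ≡⟨ cong (𝟙 (last M ρ) q *_) (proj₂ (choose-dist α ρ)) ⟩
    𝟙 (last M ρ) q * 1ℚ
      ≡⟨ *-identityʳ (𝟙 (last M ρ) q) ⟩
    𝟙 (last M ρ) q ∎

  Pr-step-chooseAt : (α : Strategy M) (ρ : Path M) (a : Fin l) (q' : Fin k) →
    Pr M α (step ρ a q') ≡ ∑ k (λ q → Pr M α ρ * ∑ (suc (nmoves q)) (λ m → chooseAt α ρ q m * δ q m a q'))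
  Pr-step-chooseAt α ρ a q' = sym (begin
    ∑ k (λ q → g q (chooseAt α ρ q))                     ≡⟨ ∑-cong k (chooseAt-𝟙 α ρ g g0≡0) ⟩
    ∑ k (λ q → 𝟙 (last M ρ) q * g (last M ρ) (choose α ρ)) ≡⟨ ∑-𝟙ʳ k (last M ρ) _ ⟩
    Pr M α (step ρ a q')                                  ∎)
    where
    g : (q : Fin k) → (Moves M q → ℚ) → ℚ
    g q c = Pr M α ρ * ∑ (suc (nmoves q)) (λ m → c m * δ q m a q')
    g0≡0 : ∀ q → g q (λ _ → 0ℚ) ≡ 0ℚ
    g0≡0 q = begin
      Pr M α ρ * ∑ (suc (nmoves q)) (λ m → 0ℚ * δ q m a q')
        ≡⟨ cong (Pr M α ρ *_) (trans (∑-cong (suc (nmoves q)) (λ m → *-zeroˡ (δ q m a q')))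
                                     (∑-zero (suc (nmoves q)))) ⟩
      Pr M α ρ * 0ℚ
        ≡⟨ *-zeroʳ (Pr M α ρ) ⟩
      0ℚ ∎

  flow : Strategy M → List (Fin l) → (q : Fin k) → Moves M q → ℚ
  flow α u q m = sumOver (pathsWith M u) (λ ρ → Pr M α ρ * chooseAt α ρ q m)

  flow-nonNeg : (α : Strategy M) (u : List (Fin l)) (q : Fin k) (m : Moves M q) → 0ℚ ≤ flow α u q m
  flow-nonNeg α u q m =
    sumOver-nonNeg (pathsWith M u) (λ ρ → *-nonNeg (Pr-nonNeg α ρ) (chooseAt-nonNeg α ρ q m))

  ∑-flow : (α : Strategy M) (u : List (Fin l)) (q : Fin k) → ∑ (suc (nmoves q)) (flow α u q) ≡ subDis M α u q
  ∑-flow α u q = begin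
    ∑ (suc (nmoves q)) (flow α u q)
      ≡⟨ ∑-sumOver-comm _ P (λ ρ m → Pr M α ρ * chooseAt α ρ q m) ⟩
    sumOver P (λ ρ → ∑ (suc (nmoves q)) (λ m → Pr M α ρ * chooseAt α ρ q m))
      ≡⟨ sumOver-cong P (λ ρ → sym (∑-*ˡ _ (Pr M α ρ) (chooseAt α ρ q))) ⟩
    sumOver P (λ ρ → Pr M α ρ * ∑ (suc (nmoves q)) (chooseAt α ρ q))
      ≡⟨ sumOver-cong P (λ ρ → trans (cong (Pr M α ρ *_) (∑-chooseAt α ρ q)) (*-comm (Pr M α ρ) _)) ⟩
    sumOver P (λ ρ → 𝟙 (last M ρ) q * Pr M α ρ)
      ≡⟨ sym (subDis-sumOver α u q) ⟩
    subDis M α u q ∎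
    where
    P : List (Path M)
    P = pathsWith M u

  ∑-flow-weighted : (α : Strategy M) (u : List (Fin l)) (q : Fin k) (c : Moves M q → ℚ) →
    ∑ (suc (nmoves q)) (λ m → flow α u q m * c m)
      ≡ sumOver (pathsWith M u) (λ ρ → Pr M α ρ * ∑ (suc (nmoves q)) (λ m → chooseAt α ρ q m * c m))
  ∑-flow-weighted α u q c = begin
    ∑ (suc (nmoves q)) (λ m → flow α u q m * c m)
      ≡⟨ ∑-cong _ (λ m → sumOver-*ʳ P (c m) (λ ρ → Pr M α ρ * chooseAt α ρ q m)) ⟩
    ∑ (suc (nmoves q)) (λ m → sumOver P (λ ρ → Pr M α ρ * chooseAt α ρ q m * c m))
      ≡⟨ ∑-sumOver-comm _ P (λ ρ m → Pr M α ρ * chooseAt α ρ q m * c m) ⟩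
    sumOver P (λ ρ → ∑ (suc (nmoves q)) (λ m → Pr M α ρ * chooseAt α ρ q m * c m))
      ≡⟨ sumOver-cong P (λ ρ → trans (∑-cong (suc (nmoves q)) (λ m → *-assoc (Pr M α ρ) (chooseAt α ρ q m) (c m)))
                                     (sym (∑-*ˡ (suc (nmoves q)) (Pr M α ρ) (λ m → chooseAt α ρ q m * c m)))) ⟩
    sumOver P (λ ρ → Pr M α ρ * ∑ (suc (nmoves q)) (λ m → chooseAt α ρ q m * c m)) ∎
    where
    P : List (Path M)
    P = pathsWith M u

  subDis-∷ʳ-flow : (α : Strategy M) (u : List (Fin l)) (a : Fin l) (q' : Fin k) →
    subDis M α (u ∷ʳ a) q' ≡ ∑ k (λ q → ∑ (suc (nmoves q)) (λ m → flow α u q m * δ q m a q'))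
  subDis-∷ʳ-flow α u a q' = begin
    subDis M α (u ∷ʳ a) q'
      ≡⟨ subDis-∷ʳ α u a q' ⟩
    sumOver P (λ ρ → Pr M α (step ρ a q'))
      ≡⟨ sumOver-cong P (λ ρ → Pr-step-chooseAt α ρ a q') ⟩
    sumOver P (λ ρ → ∑ k (λ q → Pr M α ρ * ∑ (suc (nmoves q)) (λ m → chooseAt α ρ q m * δ q m a q')))
      ≡⟨ sym (∑-sumOver-comm k P _) ⟩
    ∑ k (λ q → sumOver P (λ ρ → Pr M α ρ * ∑ (suc (nmoves q)) (λ m → chooseAt α ρ q m * δ q m a q')))
      ≡⟨ ∑-cong k (λ q → sym (∑-flow-weighted α u q (λ m → δ q m a q'))) ⟩
    ∑ k (λ q → ∑ (suc (nmoves q)) (λ m → flow α u q m * δ q m a q')) ∎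
    where
    P : List (Path M)
    P = pathsWith M u

  subDis-∷ʳ≡Succ : (α : Strategy M) (u : List (Fin l)) (μ : Fin k → ℚ) (β : LocalStrategy M) →
    (∀ q m → flow α u q m ≡ μ q * loc β q m) → ∀ a q' → subDis M α (u ∷ʳ a) q' ≡ Succ M μ β a q'
  subDis-∷ʳ≡Succ α u μ β flow≡μβ a q' = trans (subDis-∷ʳ-flow α u a q') (∑-cong k λ q → begin
    ∑ (suc (nmoves q)) (λ m → flow α u q m * δ q m a q')
      ≡⟨ ∑-cong _ (λ m → trans (cong (_* δ q m a q') (flow≡μβ q m)) (*-assoc (μ q) _ _)) ⟩
    ∑ (suc (nmoves q)) (λ m → μ q * (loc β q m * δ q m a q'))
      ≡⟨ sym (∑-*ˡ (suc (nmoves q)) (μ q) (λ m → loc β q m * δ q m a q')) ⟩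
    μ q * Δ M β a q q' ∎)

  localAfter : Strategy M → List (Fin l) → LocalStrategy M
  localAfter α u = record
    { loc      = λ q → proj₁ (normalise (flow α u q) (flow-nonNeg α u q))
    ; loc-dist = λ q → proj₁ (proj₂ (normalise (flow α u q) (flow-nonNeg α u q)))
    }

  flow-localAfter : (α : Strategy M) (u : List (Fin l)) (q : Fin k) (m : Moves M q) →
    flow α u q m ≡ subDis M α u q * loc (localAfter α u) q m
  flow-localAfter α u q m = trans (proj₂ (proj₂ (normalise (flow α u q) (flow-nonNeg α u q))) m)
                                  (cong (_* loc (localAfter α u) q m) (∑-flow α u q))

  diracLocal : LocalStrategy M
  diracLocal = record { loc = λ _ → dirac₀ ; loc-dist = λ q → dirac₀-isDist (nmoves q) }

  localAt : {n : ℕ} → Vec (LocalStrategy M) n → ℕ → LocalStrategy M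
  localAt []       _       = diracLocal
  localAt (β ∷ βs) zero    = β
  localAt (β ∷ βs) (suc j) = localAt βs j

  localAt-toℕ : {n : ℕ} (βs : Vec (LocalStrategy M) n) (i : Fin n) → localAt βs (toℕ i) ≡ lookup βs i
  localAt-toℕ (β ∷ βs) zero    = refl
  localAt-toℕ (β ∷ βs) (suc i) = localAt-toℕ βs i

  stepwise : {n : ℕ} → Vec (LocalStrategy M) n → Strategy M
  stepwise βs = record
    { choose      = λ ρ → loc (localAt βs (pathLength ρ)) (last M ρ)
    ; choose-dist = λ ρ → loc-dist (localAt βs (pathLength ρ)) (last M ρ)
    }

  chooseAt-stepwise : {n : ℕ} (βs : Vec (LocalStrategy M) n) (ρ : Path M) (q : Fin k) (m : Moves M q) →
    chooseAt (stepwise βs) ρ q m ≡ 𝟙 (last M ρ) q * loc (localAt βs (pathLength ρ)) q m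
  chooseAt-stepwise βs ρ q m with last M ρ ≟ q
  ... | yes refl = sym (*-identityˡ _)
  ... | no  _    = sym (*-zeroˡ (loc (localAt βs (pathLength ρ)) q m))

  flow-stepwise : {n : ℕ} (βs : Vec (LocalStrategy M) n) (u : List (Fin l)) (q : Fin k) (m : Moves M q) →
    flow (stepwise βs) u q m ≡ subDis M (stepwise βs) u q * loc (localAt βs (length u)) q m
  flow-stepwise βs u q m = begin
    flow α u q m
      ≡⟨ sumOver-pathsRev-cong (reverse u) (λ ρ len≡ → cong (Pr M α ρ *_)
           (trans (chooseAt-stepwise βs ρ q m)
                  (cong (λ j → 𝟙 (last M ρ) q * loc (localAt βs j) q m) (trans len≡ (length-reverse u))))) ⟩
    sumOver P (λ ρ → Pr M α ρ * (𝟙 (last M ρ) q * c))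
      ≡⟨ sumOver-cong P (λ ρ → trans (sym (*-assoc (Pr M α ρ) (𝟙 (last M ρ) q) c))
                                     (cong (_* c) (*-comm (Pr M α ρ) (𝟙 (last M ρ) q)))) ⟩
    sumOver P (λ ρ → 𝟙 (last M ρ) q * Pr M α ρ * c)
      ≡⟨ sym (sumOver-*ʳ P c _) ⟩
    sumOver P (λ ρ → 𝟙 (last M ρ) q * Pr M α ρ) * c
      ≡⟨ cong (_* c) (sym (subDis-sumOver α u q)) ⟩
    subDis M α u q * c ∎
    where
    α : Strategy M
    α = stepwise βs
    P : List (Path M)
    P = pathsWith M u
    c : ℚ
    c = loc (localAt βs (length u)) q m

  Generates : {n : ℕ} → Strategy M → Vec (Fin l) n → Vec (Fin k → ℚ) n → Set
  Generates {n} α w μs = ∀ (i : Fin (suc n)) (q : Fin k) → lookup (μ₀ ∷ μs) i q ≡ subDis M α (prefix w i) q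

  GeneratesLocally : {n : ℕ} → Vec (LocalStrategy M) n → Vec (Fin l) n → Vec (Fin k → ℚ) n → Set
  GeneratesLocally {n} βs w μs = ∀ (i : Fin n) (q' : Fin k) →
    lookup μs i q' ≡ Succ M (lookup (μ₀ ∷ μs) (inject₁ i)) (lookup βs i) (lookup w i) q'

  localsAlong : {n : ℕ} → Strategy M → Vec (Fin l) n → Vec (LocalStrategy M) n
  localsAlong α w = Vec.tabulate (λ i → localAfter α (prefix w (inject₁ i)))

  generates⇒generatesLocally : {n : ℕ} (α : Strategy M) (w : Vec (Fin l) n) (μs : Vec (Fin k → ℚ) n) →
    Generates α w μs → GeneratesLocally (localsAlong α w) w μs
  generates⇒generatesLocally α w μs gen i q' = begin
    lookup μs i q'                         ≡⟨ gen (suc i) q' ⟩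
    subDis M α (prefix w (suc i)) q'       ≡⟨ cong (λ v → subDis M α v q') (prefix-suc w i) ⟩
    subDis M α (u ∷ʳ lookup w i) q'        ≡⟨ subDis-∷ʳ≡Succ α u μ β flow≡μβ (lookup w i) q' ⟩
    Succ M μ β (lookup w i) q'             ∎
    where
    u : List (Fin l)
    u = prefix w (inject₁ i)
    μ : Fin k → ℚ
    μ = lookup (μ₀ ∷ μs) (inject₁ i)
    β : LocalStrategy M
    β = lookup (localsAlong α w) i
    flow≡μβ : ∀ q m → flow α u q m ≡ μ q * loc β q m
    flow≡μβ q m = trans (flow-localAfter α u q m)
      (cong₂ _*_ (sym (gen (inject₁ i) q)) (cong (λ β → loc β q m) (sym (lookup∘tabulate _ i))))

  stepwise-generates : {n : ℕ} (βs : Vec (LocalStrategy M) n) (w : Vec (Fin l) n) (μs : Vec (Fin k → ℚ) n) →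
    GeneratesLocally βs w μs → Generates (stepwise βs) w μs
  stepwise-generates {n} βs w μs genLoc = <-weakInduction P (λ q → sym (subDis-[] α q)) next
    where
    α : Strategy M
    α = stepwise βs
    P : Fin (suc n) → Set
    P i = ∀ q → lookup (μ₀ ∷ μs) i q ≡ subDis M α (prefix w i) q
    next : ∀ i → P (inject₁ i) → P (suc i)
    next i IH q' = begin
      lookup μs i q'                    ≡⟨ genLoc i q' ⟩
      Succ M μ (lookup βs i) a q'       ≡⟨ sym (subDis-∷ʳ≡Succ α u μ (lookup βs i) flow≡μβ a q') ⟩
      subDis M α (u ∷ʳ a) q'            ≡⟨ cong (λ v → subDis M α v q') (sym (prefix-suc w i)) ⟩
      subDis M α (prefix w (suc i)) q'  ∎
      where
      a : Fin l
      a = lookup w i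
      u : List (Fin l)
      u = prefix w (inject₁ i)
      μ : Fin k → ℚ
      μ = lookup (μ₀ ∷ μs) (inject₁ i)
      localAt-u : localAt βs (length u) ≡ lookup βs i
      localAt-u = trans (cong (localAt βs) (trans (length-prefix w (inject₁ i)) (toℕ-inject₁ i)))
                        (localAt-toℕ βs i)
      flow≡μβ : ∀ q m → flow α u q m ≡ μ q * loc (lookup βs i) q m
      flow≡μβ q m = trans (flow-stepwise βs u q m) (cong₂ _*_ (sym (IH q)) (cong (λ β → loc β q m) localAt-u))

lemma3 : {k l : ℕ} (M : MDP k l) {n : ℕ} (w : Vec (Fin l) n)
         (μs : Vec (Fin k → ℚ) n) → (∀ i → IsSubDist k (lookup μs i)) →
         (Σ (Strategy M) λ α → ∀ (i : Fin (suc n)) (q : Fin k) →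
            lookup (MDP.μ₀ M ∷ μs) i q ≡ subDis M α (prefix w i) q)
         ⇔
         (Σ (Vec (LocalStrategy M) n) λ αs → ∀ (i : Fin n) (q' : Fin k) →
            lookup μs i q' ≡
              Succ M (lookup (MDP.μ₀ M ∷ μs) (inject₁ i)) (lookup αs i) (lookup w i) q')
lemma3 M w μs _ = mk⇔
  (λ (α , gen) → localsAlong M α w , generates⇒generatesLocally M α w μs gen)
  (λ (βs , genLoc) → stepwise M βs , stepwise-generates M βs w μs genLoc)
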